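{- One has $\mathcal{C}_{\mathsf{GS}}\subset\mathcal{C}_{\mathsf{lw}}$.
   Context: $q$ prime power, $k=\overline{\mathbb{F}}_q$, $\sigma$ the $q$-Frobenius acting on roots, coroots, Weyl groups. $G$ connected reductive over $\mathbb{F}_q$, $\mu$ cocharacter of $G_k$ with centralizer $L$, $P$ the parabolic of $g$ with $t\mapsto\mu(t)^{ -1}g\mu(t)$ extending to $\mathbb{A}^1$. A Borel pair $(B,T)$ over $\mathbb{F}_q$ with $B\subset P$ is fixed; $\Phi^+$ the roots whose root group lies in the opposite Borel; $\Delta$ simple roots, $I$ simple roots of $L$, $\Phi^+_L$ positive roots of $L$, $w_{0,I}$ longest in $W_I$, $\ell$ length. $L_0=\bigcap_{n\ge0}L^{(q^n)}$, $I_0$ its simple roots, $w_{0,I_0}$ longest in $W_{I_0}$, $\Delta^{P_0}=\Delta\setminus I_0$, $W_{L_0}(\mathbb{F}_q)$ the $\sigma$-fixed elements of $W_{I_0}$, $r_\alpha$ the least $r\ge1$ with $\sigma^r(\alpha)=\alpha$. $\mathcal{C}_{\mathsf{GS}}$: $\lambda\in X^*(T)$ with $\langle\lambda,\alpha^\vee\rangle\ge0$ for $\alpha\in I$ and $\le0$ for $\alpha\in\Phi^+\setminus\Phi^+_L$. $\mathcal{C}_{\mathsf{lw}}$: the set of $\lambda$ with $\langle\lambda,\alpha^\vee\rangle\ge0$ for all $\alpha\in I$ such that, putting $\lambda_0=w_{0,I_0}w_{0,I}\lambda$, for all $\alpha\in\Delta^{P_0}$: $\sum_{w\in W_{L_0}(\mathbb{F}_q)}\sum_{i=0}^{r_\alpha-1}q^{i+\ell(w)}\langle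 w\lambda_0,\sigma^i(\alpha^\vee)\rangle\le0$. -}

module Defs where

open import Data.Nat as ℕ using (ℕ; zero; suc)
open import Data.Nat.Primality using (Prime)
open import Data.Integer as ℤ using (ℤ; +_; 0ℤ; _+_; _*_; _-_; -_; _≤_)
open import Data.Fin using (Fin; zero; suc)
open import Data.Bool using (Bool; true)
open import Data.List using (List; []; _∷_; _++_; map; length; lookup)
open import Data.List.Relation.Unary.All using (All)
open import Data.Product using (Σ; ∃; ∃₂; _×_; _,_; proj₁; proj₂)
open import Data.Sum using (_⊎_)
open import Relation.Binary.PropositionalEquality using (_≡_; _≢_)
open import Relation.Nullary using (¬_)

Σℤ : (n : ℕ) → (Fin n → ℤ) → ℤ
Σℤ zero    f = 0ℤ
Σℤ (suc n) f = f zero + Σℤ n (λ i → f (suc i))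

Σℕ : ℕ → (ℕ → ℤ) → ℤ
Σℕ zero    f = 0ℤ
Σℕ (suc r) f = Σℕ r f + f r

-- X*(T) and X_*(T) are both modelled as ℤ^n, with the standard pairing
Lat : ℕ → Set
Lat n = Fin n → ℤ

⟪_,_⟫ : ∀ {n} → Lat n → Lat n → ℤ
⟪_,_⟫ {n} x y = Σℤ n (λ i → x i * y i)

_≋_ : ∀ {n} → Lat n → Lat n → Set
x ≋ y = ∀ i → x i ≡ y i

_•_ : ∀ {n} → ℤ → Lat n → Lat n
(c • x) i = c * x i

_⊖_ : ∀ {n} → Lat n → Lat n → Lat n
(x ⊖ y) i = x i - y i

𝟘 : ∀ {n} → Lat n
𝟘 i = 0ℤ

Mat : ℕ → Set
Mat n = Fin n → Fin n → ℤ

app : ∀ {n} → Mat n → Lat n → Lat n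
app {n} M x i = Σℤ n (λ j → M i j * x j)

appᵀ : ∀ {n} → Mat n → Lat n → Lat n
appᵀ {n} M y i = Σℤ n (λ j → M j i * y j)

_^[_] : ∀ {A : Set} → (A → A) → ℕ → A → A
(f ^[ zero ])  a = a
(f ^[ suc k ]) a = f ((f ^[ k ]) a)

IsPrimePower : ℕ → Set
IsPrimePower q = ∃₂ λ p k → Prime p × 1 ℕ.≤ k × q ≡ p ℕ.^ k

-- Reduced root datum (Φ ⊂ X = ℤ^n, Φ^∨ ⊂ X^∨ = ℤ^n), roots indexed by Fin m,
-- α_i ↦ α_i^∨ the given bijection.

record RootDatum (n : ℕ) : Set where
  field
    m      : ℕ
    root   : Fin m → Lat n
    coroot : Fin m → Lat n

  s : Fin m → Lat n → Lat n
  s i x = x ⊖ (⟪ x , coroot i ⟫ • root i)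

  s∨ : Fin m → Lat n → Lat n
  s∨ i y = y ⊖ (⟪ root i , y ⟫ • coroot i)

  field
    root-inj      : ∀ i j → root i ≋ root j → i ≡ j
    coroot-inj    : ∀ i j → coroot i ≋ coroot j → i ≡ j
    pair-two      : ∀ i → ⟪ root i , coroot i ⟫ ≡ + 2
    refl-closed   : ∀ i j → ∃ λ k → s i (root j) ≋ root k
    corefl-closed : ∀ i j → ∃ λ k → s∨ i (coroot j) ≋ coroot k
    -- reduced: the only rational multiples of a root that are roots are ±α
    reduced       : ∀ i j (a b : ℤ) → a ≢ 0ℤ →
                    (a • root j) ≋ (b • root i) → a ≡ b ⊎ a ≡ - b

-- Root datum of (G,T) for G connected reductive over F_q, together with
-- the base Δ of the positive system Φ⁺ attached to the F_q-Borel, and the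
-- Frobenius action: a lattice automorphism τ of finite order (F = q·τ on X*(T))
-- inducing the permutation σ of the roots, with (σα)^∨ = (τ⁻¹)ᵀ α^∨.

record FrobRootDatum (n : ℕ) : Set where
  field
    RD : RootDatum n
  open RootDatum RD public
  field
    simple : Fin m → Bool

  Δ : Fin m → Set
  Δ i = simple i ≡ true

  Supported : (Fin m → ℤ) → Set
  Supported c = ∀ j → ¬ Δ j → c j ≡ 0ℤ

  lincomb : (Fin m → ℤ) → Lat n
  lincomb c k = Σℤ m (λ j → c j * root j k)

  field
    base-span  : ∀ i → ∃ λ c → Supported c ×
                   ((∀ j → 0ℤ ≤ c j) ⊎ (∀ j → c j ≤ 0ℤ)) × root i ≋ lincomb c
    base-indep : ∀ c → Supported c → lincomb c ≋ 𝟘 → ∀ j → c j ≡ 0ℤ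
    τ     : Mat n
    τ⁻¹   : Mat n
    τ-inv₁ : ∀ x → app τ (app τ⁻¹ x) ≋ x
    τ-inv₂ : ∀ x → app τ⁻¹ (app τ x) ≋ x
    τ-finite : ∃ λ N → 1 ℕ.≤ N × ∀ x → (app τ ^[ N ]) x ≋ x
    σ     : Fin m → Fin m
    σ-root   : ∀ i → root (σ i) ≋ app τ (root i)
    σ-coroot : ∀ i → coroot (σ i) ≋ appᵀ τ⁻¹ (coroot i)
    σ-simple : ∀ i → Δ i → Δ (σ i)

module _ {n : ℕ} (D : FrobRootDatum n) where
  open FrobRootDatum D

  Pos : Fin m → Set
  Pos i = ∃ λ c → Supported c × (∀ j → 0ℤ ≤ c j) × root i ≋ lincomb c

  -- cocharacter μ with B ⊂ P(μ)  (⟨α,μ⟩ ≥ 0 for α ∈ Φ⁺)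
  Dominant : Lat n → Set
  Dominant μ = ∀ i → Pos i → 0ℤ ≤ ⟪ root i , μ ⟫

  -- Weyl group elements as words of reflections, acting on X*(T):
  -- act (u ++ v) = act u ∘ act v
  act : List (Fin m) → Lat n → Lat n
  act []      x = x
  act (i ∷ w) x = s i (act w x)

  _~_ : List (Fin m) → List (Fin m) → Set
  u ~ v = ∀ x → act u x ≋ act v x

  HasLength : List (Fin m) → ℕ → Set
  HasLength w k = (∃ λ v → All Δ v × length v ≡ k × v ~ w)
                × (∀ v → All Δ v → v ~ w → k ℕ.≤ length v)

  IsLongestIn : (Fin m → Set) → List (Fin m) → Set
  IsLongestIn J w = All J w × ∃ λ k → HasLength w k ×
                      (∀ v k' → All J v → HasLength v k' → k' ℕ.≤ k)

  module _ (μ : Lat n) where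
    -- roots of L = Cent(μ)
    InL : Fin m → Set
    InL i = ⟪ root i , μ ⟫ ≡ 0ℤ

    I : Fin m → Set
    I i = Δ i × InL i

    -- I₀ : simple roots of L₀ = ⋂_k L^(q^k), i.e. ⋂_k σ^k(I)
    I₀ : Fin m → Set
    I₀ i = Δ i × ∀ k → ∃ λ j → I j × (σ ^[ k ]) j ≡ i

    InCGS : Lat n → Set
    InCGS λ' = (∀ i → I i → 0ℤ ≤ ⟪ λ' , coroot i ⟫)
             × (∀ i → Pos i → ¬ InL i → ⟪ λ' , coroot i ⟫ ≤ 0ℤ)

    -- E enumerates W_{L₀}(F_q) = (W_{I₀})^σ without repetition, each
    -- element listed with its length
    EnumWL0Fq : List (List (Fin m) × ℕ) → Set
    EnumWL0Fq E =
        All (λ e → All I₀ (proj₁ e) × map σ (proj₁ e) ~ proj₁ e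
                   × HasLength (proj₁ e) (proj₂ e)) E
      × (∀ v → All I₀ v → map σ v ~ v →
           ∃ λ (p : Fin (length E)) → proj₁ (lookup E p) ~ v
             × (∀ p' → proj₁ (lookup E p') ~ v → p' ≡ p))

    OrbitLen : Fin m → ℕ → Set
    OrbitLen α r = 1 ℕ.≤ r × (σ ^[ r ]) α ≡ α
                 × (∀ r' → 1 ℕ.≤ r' → r' ℕ.< r → (σ ^[ r' ]) α ≢ α)

    lwSum : ℕ → List (List (Fin m) × ℕ) → Lat n → Fin m → ℕ → ℤ
    lwSum q []            λ₀ α r = 0ℤ
    lwSum q ((w , k) ∷ E) λ₀ α r =
      Σℕ r (λ i → + (q ℕ.^ (i ℕ.+ k)) * ⟪ act w λ₀ , coroot ((σ ^[ i ]) α) ⟫)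
      + lwSum q E λ₀ α r

    InClw : ℕ → Lat n → Set
    InClw q λ' =
        (∀ i → I i → 0ℤ ≤ ⟪ λ' , coroot i ⟫)
      × (∀ w0I w0I₀ → IsLongestIn I w0I → IsLongestIn I₀ w0I₀ →
           ∀ E → EnumWL0Fq E →
           ∀ α → Δ α → ¬ I₀ α → ∀ r → OrbitLen α r →
           lwSum q E (act (w0I₀ ++ w0I) λ') α r ≤ 0ℤ)

module Submission where

open import Defs
open import Data.Nat as ℕ using (ℕ; zero; suc)
import Data.Nat.Properties as ℕP
open import Data.Integer as ℤ using (ℤ; +_; 0ℤ; 1ℤ; _+_; _*_; _-_; -_; _≤_; _<_; -[1+_]; +≤+; +<+)
import Data.Integer.Properties as ℤP
open import Data.Integer.Tactic.RingSolver using (solve-∀)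
open import Data.Fin using (Fin; zero; suc; _≟_)
open import Data.Fin.Permutation using (permutation)
open import Algebra.Properties.Semiring.Sum ℤP.+-*-semiring using (sum; ∑-comm; sum-permute)
import Data.Bool as Bool
open import Data.List using (List; []; _∷_; _++_; length; reverse; [_])
import Data.List.Properties as List
open import Data.List.Relation.Unary.All as All using (All; []; _∷_)
open import Data.List.Relation.Unary.All.Properties using (++⁺)
open import Data.Product using (∃; _×_; _,_; proj₁; proj₂)
open import Data.Sum using (_⊎_; inj₁; inj₂)
open import Data.Empty using (⊥-elim)
open import Function using (_∘_)
open import Relation.Nullary using (¬_; contradiction; Dec; yes; no)
open import Relation.Binary.PropositionalEquality hiding ([_])

-- Each summand of the 𝒞_lw sum is a nonnegative multiple of ⟨ v y , β^∨ ⟩,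
-- where y = w₀,I λ, v = w w₀,I₀ lies in W_{I₀} and β = σ^i α is a simple root
-- outside I₀ (by injectivity of σ).  For λ ∈ 𝒞_GS the weight y
-- is antidominant: for a simple root p of L, w₀,I⁻¹ p is a negative root of L,
-- and λ is L-dominant; for a simple root p outside L, w₀,I⁻¹ p is a positive
-- root with p-coefficient 1, hence (μ being dominant) a positive root outside
-- L, on whose coroot λ is nonpositive.  Finally v⁻¹ β is a positive root, since
-- W_{I₀} does not change the β-coordinate, so ⟨ v y , β^∨ ⟩ = ⟨ y , (v⁻¹ β)^∨ ⟩ ≤ 0.

nonNeg*nonPos≤0 : ∀ {a b} → 0ℤ ≤ a → b ≤ 0ℤ → a * b ≤ 0ℤ
nonNeg*nonPos≤0 {a} 0≤a b≤0 =
  ℤP.≤-trans (ℤP.*-monoˡ-≤-nonNeg a {{ℤ.nonNegative 0≤a}} b≤0) (ℤP.≤-reflexive (ℤP.*-zeroʳ a))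

nonPos*nonNeg≤0 : ∀ {a b} → a ≤ 0ℤ → 0ℤ ≤ b → a * b ≤ 0ℤ
nonPos*nonNeg≤0 {a} {b} a≤0 0≤b = subst (_≤ 0ℤ) (ℤP.*-comm b a) (nonNeg*nonPos≤0 0≤b a≤0)

nonNeg*nonNeg≥0 : ∀ {a b} → 0ℤ ≤ a → 0ℤ ≤ b → 0ℤ ≤ a * b
nonNeg*nonNeg≥0 {a} 0≤a 0≤b =
  ℤP.≤-trans (ℤP.≤-reflexive (sym (ℤP.*-zeroʳ a))) (ℤP.*-monoˡ-≤-nonNeg a {{ℤ.nonNegative 0≤a}} 0≤b)

square≥0 : ∀ a → 0ℤ ≤ a * a
square≥0 (+ n)    = nonNeg*nonNeg≥0 {+ n} {+ n} (+≤+ ℕ.z≤n) (+≤+ ℕ.z≤n)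
square≥0 -[1+ n ] = ℤP.≤-trans (ℤP.≤-reflexive (sym (ℤP.*-zeroʳ -[1+ n ])))
                               (ℤP.*-monoˡ-≤-nonPos -[1+ n ] ℤ.-≤+)

*-cancelʳ-≤0 : ∀ {a c} → 0ℤ < c → a * c ≤ 0ℤ → a ≤ 0ℤ
*-cancelʳ-≤0 {a} {c} 0<c ac≤0 =
  ℤP.*-cancelʳ-≤-pos a 0ℤ c {{ℤ.positive 0<c}} (ℤP.≤-trans ac≤0 (ℤP.≤-reflexive (sym (ℤP.*-zeroˡ c))))

1≰0 : ¬ (1ℤ ≤ 0ℤ)
1≰0 (+≤+ ())

≡0⇒*≤0 : ∀ {a} b → a ≡ 0ℤ → a * b ≤ 0ℤ
≡0⇒*≤0 b refl = ℤP.≤-refl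

≡0⇒*≥0 : ∀ {a} b → a ≡ 0ℤ → 0ℤ ≤ a * b
≡0⇒*≥0 b refl = ℤP.≤-refl

x-a*0≡x : ∀ x a → x - a * 0ℤ ≡ x
x-a*0≡x = solve-∀

Σℤ≡sum : ∀ n (f : Fin n → ℤ) → Σℤ n f ≡ sum f
Σℤ≡sum zero    f = refl
Σℤ≡sum (suc n) f = cong (λ s → f zero + s) (Σℤ≡sum n (f ∘ suc))

Σ-cong : ∀ n {f g : Fin n → ℤ} → (∀ i → f i ≡ g i) → Σℤ n f ≡ Σℤ n g
Σ-cong zero    f≗g = refl
Σ-cong (suc n) f≗g = cong₂ _+_ (f≗g zero) (Σ-cong n (f≗g ∘ suc))

Σ-linear : ∀ n a (f g : Fin n → ℤ) → Σℤ n (λ i → f i - a * g i) ≡ Σℤ n f - a * Σℤ n g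
Σ-linear zero    a f g = sym (x-a*0≡x 0ℤ a)
Σ-linear (suc n) a f g =
  trans (cong (λ s → f zero - a * g zero + s) (Σ-linear n a (f ∘ suc) (g ∘ suc)))
        (regroup a (f zero) (g zero) (Σℤ n (f ∘ suc)) (Σℤ n (g ∘ suc)))
  where
    regroup : ∀ a x y X Y → x - a * y + (X - a * Y) ≡ x + X - a * (y + Y)
    regroup = solve-∀

Σ-scale : ∀ n a (f : Fin n → ℤ) → Σℤ n (λ i → a * f i) ≡ a * Σℤ n f
Σ-scale zero    a f = sym (ℤP.*-zeroʳ a)
Σ-scale (suc n) a f =
  trans (cong (λ s → a * f zero + s) (Σ-scale n a (f ∘ suc))) (sym (ℤP.*-distribˡ-+ a (f zero) _))

Σ-comm : ∀ k l (f : Fin k → Fin l → ℤ) →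
         Σℤ k (λ i → Σℤ l (f i)) ≡ Σℤ l (λ j → Σℤ k (λ i → f i j))
Σ-comm k l f = begin
  Σℤ k (λ i → Σℤ l (f i))          ≡⟨ Σ-cong k (λ i → Σℤ≡sum l (f i)) ⟩
  Σℤ k (λ i → sum (f i))           ≡⟨ Σℤ≡sum k _ ⟩
  sum (λ i → sum (f i))            ≡⟨ ∑-comm f ⟩
  sum (λ j → sum (λ i → f i j))    ≡⟨ Σℤ≡sum l _ ⟨
  Σℤ l (λ j → sum (λ i → f i j))   ≡⟨ Σ-cong l (λ j → Σℤ≡sum k (λ i → f i j)) ⟨
  Σℤ l (λ j → Σℤ k (λ i → f i j))  ∎
  where open ≡-Reasoning

Σ-interchange : ∀ k l (a : Fin k → ℤ) (c : Fin l → ℤ) (g : Fin l → Fin k → ℤ) →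
                Σℤ k (λ i → a i * Σℤ l (λ j → c j * g j i)) ≡ Σℤ l (λ j → c j * Σℤ k (λ i → a i * g j i))
Σ-interchange k l a c g = begin
  Σℤ k (λ i → a i * Σℤ l (λ j → c j * g j i))   ≡⟨ Σ-cong k (λ i → Σ-scale l (a i) _) ⟨
  Σℤ k (λ i → Σℤ l (λ j → a i * (c j * g j i))) ≡⟨ Σ-comm k l _ ⟩
  Σℤ l (λ j → Σℤ k (λ i → a i * (c j * g j i)))
    ≡⟨ Σ-cong l (λ j → Σ-cong k (λ i → swap (a i) (c j) (g j i))) ⟩
  Σℤ l (λ j → Σℤ k (λ i → c j * (a i * g j i))) ≡⟨ Σ-cong l (λ j → Σ-scale k (c j) _) ⟩
  Σℤ l (λ j → c j * Σℤ k (λ i → a i * g j i))   ∎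
  where
    open ≡-Reasoning
    swap : ∀ x y z → x * (y * z) ≡ y * (x * z)
    swap = solve-∀

Σ-involution : ∀ n (π : Fin n → Fin n) → (∀ i → π (π i) ≡ i) → (f : Fin n → ℤ) →
               Σℤ n (f ∘ π) ≡ Σℤ n f
Σ-involution n π π-inv f = begin
  Σℤ n (f ∘ π)   ≡⟨ Σℤ≡sum n (f ∘ π) ⟩
  sum (f ∘ π)    ≡⟨ sum-permute f (permutation π π π-inv π-inv) ⟨
  sum f          ≡⟨ Σℤ≡sum n f ⟨
  Σℤ n f         ∎
  where open ≡-Reasoning

Σ-nonNeg : ∀ n (f : Fin n → ℤ) → (∀ i → 0ℤ ≤ f i) → 0ℤ ≤ Σℤ n f
Σ-nonNeg zero    f f≥0 = ℤP.≤-refl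
Σ-nonNeg (suc n) f f≥0 = ℤP.+-mono-≤ (f≥0 zero) (Σ-nonNeg n (f ∘ suc) (f≥0 ∘ suc))

Σ-nonPos : ∀ n (f : Fin n → ℤ) → (∀ i → f i ≤ 0ℤ) → Σℤ n f ≤ 0ℤ
Σ-nonPos zero    f f≤0 = ℤP.≤-refl
Σ-nonPos (suc n) f f≤0 = ℤP.+-mono-≤ (f≤0 zero) (Σ-nonPos n (f ∘ suc) (f≤0 ∘ suc))

term≤Σ-nonNeg : ∀ n (f : Fin n → ℤ) → (∀ i → 0ℤ ≤ f i) → ∀ k → f k ≤ Σℤ n f
term≤Σ-nonNeg (suc n) f f≥0 zero    = ℤP.i≤i+j (f zero) _ {{ℤ.nonNegative (Σ-nonNeg n (f ∘ suc) (f≥0 ∘ suc))}}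
term≤Σ-nonNeg (suc n) f f≥0 (suc k) =
  ℤP.i≤j⇒i≤k+j (f zero) {{ℤ.nonNegative (f≥0 zero)}} (term≤Σ-nonNeg n (f ∘ suc) (f≥0 ∘ suc) k)

Σℕ-nonPos : ∀ r (f : ℕ → ℤ) → (∀ i → f i ≤ 0ℤ) → Σℕ r f ≤ 0ℤ
Σℕ-nonPos zero    f f≤0 = ℤP.≤-refl
Σℕ-nonPos (suc r) f f≤0 = ℤP.+-mono-≤ (Σℕ-nonPos r f f≤0) (f≤0 r)

δ : ∀ {n} → Fin n → Fin n → ℤ
δ zero    zero    = 1ℤ
δ zero    (suc i) = 0ℤ
δ (suc k) zero    = 0ℤ
δ (suc k) (suc i) = δ k i

δ-diag : ∀ {n} (k : Fin n) → δ k k ≡ 1ℤ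
δ-diag zero    = refl
δ-diag (suc k) = δ-diag k

δ-off : ∀ {n} (k i : Fin n) → k ≢ i → δ k i ≡ 0ℤ
δ-off zero    zero    k≢i = contradiction refl k≢i
δ-off zero    (suc i) k≢i = refl
δ-off (suc k) zero    k≢i = refl
δ-off (suc k) (suc i) k≢i = δ-off k i (k≢i ∘ cong suc)

Σ-δ : ∀ n (k : Fin n) (f : Fin n → ℤ) → Σℤ n (λ i → δ k i * f i) ≡ f k
Σ-δ (suc n) zero    f = begin
  1ℤ * f zero + Σℤ n (λ i → 0ℤ * f (suc i))
    ≡⟨ cong₂ _+_ (ℤP.*-identityˡ (f zero)) (Σ-scale n 0ℤ (f ∘ suc)) ⟩
  f zero + 0ℤ                                ≡⟨ ℤP.+-identityʳ (f zero) ⟩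
  f zero                                     ∎
  where open ≡-Reasoning
Σ-δ (suc n) (suc k) f = trans (cong₂ _+_ (ℤP.*-zeroˡ (f zero)) (Σ-δ n k (f ∘ suc))) (ℤP.+-identityˡ (f (suc k)))

δ-nonNeg : ∀ {n} (k i : Fin n) → 0ℤ ≤ δ k i
δ-nonNeg zero    zero    = +≤+ ℕ.z≤n
δ-nonNeg zero    (suc i) = +≤+ ℕ.z≤n
δ-nonNeg (suc k) zero    = +≤+ ℕ.z≤n
δ-nonNeg (suc k) (suc i) = δ-nonNeg k i

module _ {n : ℕ} where

  ⟪⟫-congˡ : ∀ {x x′ : Lat n} y → x ≋ x′ → ⟪ x , y ⟫ ≡ ⟪ x′ , y ⟫
  ⟪⟫-congˡ y x≋x′ = Σ-cong n (λ i → cong (_* y i) (x≋x′ i))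

  ⟪⟫-congʳ : ∀ x {y y′ : Lat n} → y ≋ y′ → ⟪ x , y ⟫ ≡ ⟪ x , y′ ⟫
  ⟪⟫-congʳ x y≋y′ = Σ-cong n (λ i → cong (x i *_) (y≋y′ i))

  ⟪⟫-comm : ∀ (x y : Lat n) → ⟪ x , y ⟫ ≡ ⟪ y , x ⟫
  ⟪⟫-comm x y = Σ-cong n (λ i → ℤP.*-comm (x i) (y i))

  ⟪⊖⟫ˡ : ∀ (x y z : Lat n) a → ⟪ x ⊖ (a • y) , z ⟫ ≡ ⟪ x , z ⟫ - a * ⟪ y , z ⟫
  ⟪⊖⟫ˡ x y z a = trans (Σ-cong n (λ i → distrib a (x i) (y i) (z i))) (Σ-linear n a _ _)
    where
      distrib : ∀ a x y z → (x - a * y) * z ≡ x * z - a * (y * z)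
      distrib = solve-∀

  ⟪⊖⟫ʳ : ∀ (z x y : Lat n) a → ⟪ z , x ⊖ (a • y) ⟫ ≡ ⟪ z , x ⟫ - a * ⟪ z , y ⟫
  ⟪⊖⟫ʳ z x y a = begin
    ⟪ z , x ⊖ (a • y) ⟫        ≡⟨ ⟪⟫-comm z _ ⟩
    ⟪ x ⊖ (a • y) , z ⟫        ≡⟨ ⟪⊖⟫ˡ x y z a ⟩
    ⟪ x , z ⟫ - a * ⟪ y , z ⟫  ≡⟨ cong₂ (λ u v → u - a * v) (⟪⟫-comm x z) (⟪⟫-comm y z) ⟩
    ⟪ z , x ⟫ - a * ⟪ z , y ⟫  ∎
    where open ≡-Reasoning

  ⟪Σ⟫ˡ : ∀ m (c : Fin m → ℤ) (v : Fin m → Lat n) y →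
         ⟪ (λ k → Σℤ m (λ j → c j * v j k)) , y ⟫ ≡ Σℤ m (λ j → c j * ⟪ v j , y ⟫)
  ⟪Σ⟫ˡ m c v y = begin
    ⟪ (λ k → Σℤ m (λ j → c j * v j k)) , y ⟫  ≡⟨ ⟪⟫-comm _ y ⟩
    Σℤ n (λ k → y k * Σℤ m (λ j → c j * v j k)) ≡⟨ Σ-interchange n m y c v ⟩
    Σℤ m (λ j → c j * ⟪ y , v j ⟫)             ≡⟨ Σ-cong m (λ j → cong (c j *_) (⟪⟫-comm y (v j))) ⟩
    Σℤ m (λ j → c j * ⟪ v j , y ⟫)             ∎
    where open ≡-Reasoning

  reflection-involutive : (f : Lat n → ℤ) → (∀ x y a → f (x ⊖ (a • y)) ≡ f x - a * f y) →
                          ∀ u → f u ≡ + 2 → ∀ x → let x′ = x ⊖ (f x • u) in (x′ ⊖ (f x′ • u)) ≋ x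
  reflection-involutive f f-linear u fu≡2 x k = begin
    x k - f x * u k - f (x ⊖ (f x • u)) * u k  ≡⟨ cong (λ t → x k - f x * u k - t * u k) f-x′ ⟩
    x k - f x * u k - (f x - f x * + 2) * u k  ≡⟨ cancel (x k) (f x) (u k) ⟩
    x k                                        ∎
    where
      open ≡-Reasoning
      f-x′ : f (x ⊖ (f x • u)) ≡ f x - f x * + 2
      f-x′ = trans (f-linear x u (f x)) (cong (λ t → f x - f x * t) fu≡2)
      cancel : ∀ a b c → a - b * c - (b - b * + 2) * c ≡ a
      cancel = solve-∀

app-cong : ∀ {n} (M : Mat n) {x y : Lat n} → x ≋ y → app M x ≋ app M y
app-cong {n} M x≋y i = Σ-cong n (λ j → cong (M i j *_) (x≋y j))

^[]-+ : ∀ {A : Set} (f : A → A) a b x → (f ^[ a ℕ.+ b ]) x ≡ (f ^[ a ]) ((f ^[ b ]) x)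
^[]-+ f zero    b x = refl
^[]-+ f (suc a) b x = cong f (^[]-+ f a b x)

All-reverse : ∀ {A : Set} {P : A → Set} {xs : List A} → All P xs → All P (reverse xs)
All-reverse {P = P} {[]}     []         = []
All-reverse {P = P} {x ∷ xs} (px ∷ pxs) =
  subst (All P) (sym (List.unfold-reverse x xs)) (++⁺ (All-reverse pxs) (px ∷ []))

module RootDatumTheory {n : ℕ} (D : FrobRootDatum n) where
  open FrobRootDatum D

  s-cong : ∀ i {x y : Lat n} → x ≋ y → s i x ≋ s i y
  s-cong i x≋y k = cong₂ (λ u v → u - v * root i k) (x≋y k) (⟪⟫-congˡ (coroot i) x≋y)

  s-linear : ∀ i (x y : Lat n) a → s i (x ⊖ (a • y)) ≋ (s i x ⊖ (a • s i y))
  s-linear i x y a k = begin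
    x k - a * y k - ⟪ x ⊖ (a • y) , coroot i ⟫ * root i k
      ≡⟨ cong (λ t → x k - a * y k - t * root i k) (⟪⊖⟫ˡ x y (coroot i) a) ⟩
    x k - a * y k - (⟪ x , coroot i ⟫ - a * ⟪ y , coroot i ⟫) * root i k
      ≡⟨ regroup (x k) a (y k) ⟪ x , coroot i ⟫ ⟪ y , coroot i ⟫ (root i k) ⟩
    x k - ⟪ x , coroot i ⟫ * root i k - a * (y k - ⟪ y , coroot i ⟫ * root i k)
      ∎
    where
      open ≡-Reasoning
      regroup : ∀ x a y P Q r → x - a * y - (P - a * Q) * r ≡ x - P * r - a * (y - Q * r)
      regroup = solve-∀

  s-root-self : ∀ i → s i (root i) ≋ (root i ⊖ ((+ 2) • root i))
  s-root-self i k = cong (λ t → root i k - t * root i k) (pair-two i)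

  s-involutive : ∀ i (x : Lat n) → s i (s i x) ≋ x
  s-involutive i = reflection-involutive (λ x → ⟪ x , coroot i ⟫) (λ x y → ⟪⊖⟫ˡ x y (coroot i)) (root i) (pair-two i)

  s∨-involutive : ∀ i (y : Lat n) → s∨ i (s∨ i y) ≋ y
  s∨-involutive i = reflection-involutive (λ y → ⟪ root i , y ⟫) (⟪⊖⟫ʳ (root i)) (coroot i) (pair-two i)

  s-adjoint : ∀ i (x y : Lat n) → ⟪ s i x , y ⟫ ≡ ⟪ x , s∨ i y ⟫
  s-adjoint i x y = begin
    ⟪ s i x , y ⟫                                  ≡⟨ ⟪⊖⟫ˡ x (root i) y ⟪ x , coroot i ⟫ ⟩
    ⟪ x , y ⟫ - ⟪ x , coroot i ⟫ * ⟪ root i , y ⟫  ≡⟨ cong (λ t → ⟪ x , y ⟫ - t) (ℤP.*-comm ⟪ x , coroot i ⟫ _) ⟩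
    ⟪ x , y ⟫ - ⟪ root i , y ⟫ * ⟪ x , coroot i ⟫  ≡⟨ ⟪⊖⟫ʳ x y (coroot i) ⟪ root i , y ⟫ ⟨
    ⟪ x , s∨ i y ⟫                                 ∎
    where open ≡-Reasoning

  s∨-coroot : Fin m → Fin m → Fin m
  s∨-coroot i β = proj₁ (corefl-closed i β)

  s∨-coroot-spec : ∀ i β → s∨ i (coroot β) ≋ coroot (s∨-coroot i β)
  s∨-coroot-spec i β = proj₂ (corefl-closed i β)

  s∨-coroot-involutive : ∀ i β → s∨-coroot i (s∨-coroot i β) ≡ β
  s∨-coroot-involutive i β = coroot-inj _ _ λ k → begin
    coroot (s∨-coroot i (s∨-coroot i β)) k  ≡⟨ s∨-coroot-spec i (s∨-coroot i β) k ⟨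
    s∨ i (coroot (s∨-coroot i β)) k         ≡⟨ s∨-cong (s∨-coroot-spec i β) k ⟨
    s∨ i (s∨ i (coroot β)) k                ≡⟨ s∨-involutive i (coroot β) k ⟩
    coroot β k                              ∎
    where
      open ≡-Reasoning
      s∨-cong : ∀ {y y′} → y ≋ y′ → s∨ i y ≋ s∨ i y′
      s∨-cong y≋y′ k = cong₂ (λ u v → u - v * coroot i k) (y≋y′ k) (⟪⟫-congʳ (root i) y≋y′)

  -- The axioms do not identify the coroot of s i α with s∨ i α^∨, so coroots
  -- are handled through this W-invariant form: by form-root, ⟪ x , α^∨ ⟫ is
  -- 2 form x α / form α α.
  form : Lat n → Lat n → ℤ
  form x y = Σℤ m (λ β → ⟪ x , coroot β ⟫ * ⟪ y , coroot β ⟫)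

  form-congˡ : ∀ {x x′} y → x ≋ x′ → form x y ≡ form x′ y
  form-congˡ y x≋x′ = Σ-cong m (λ β → cong (_* ⟪ y , coroot β ⟫) (⟪⟫-congˡ (coroot β) x≋x′))

  form-congʳ : ∀ x {y y′} → y ≋ y′ → form x y ≡ form x y′
  form-congʳ x y≋y′ = Σ-cong m (λ β → cong (⟪ x , coroot β ⟫ *_) (⟪⟫-congˡ (coroot β) y≋y′))

  form-comm : ∀ x y → form x y ≡ form y x
  form-comm x y = Σ-cong m (λ β → ℤP.*-comm ⟪ x , coroot β ⟫ _)

  form-s-invariant : ∀ i x y → form (s i x) (s i y) ≡ form x y
  form-s-invariant i x y = begin
    form (s i x) (s i y)
      ≡⟨ Σ-cong m (λ β → cong₂ _*_ (pull x β) (pull y β)) ⟩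
    Σℤ m (λ β → ⟪ x , coroot (s∨-coroot i β) ⟫ * ⟪ y , coroot (s∨-coroot i β) ⟫)
      ≡⟨ Σ-involution m (s∨-coroot i) (s∨-coroot-involutive i) (λ β → ⟪ x , coroot β ⟫ * ⟪ y , coroot β ⟫) ⟩
    form x y
      ∎
    where
      open ≡-Reasoning
      pull : ∀ z β → ⟪ s i z , coroot β ⟫ ≡ ⟪ z , coroot (s∨-coroot i β) ⟫
      pull z β = trans (s-adjoint i z (coroot β)) (⟪⟫-congʳ z (s∨-coroot-spec i β))

  form-⊖ˡ : ∀ x y z a → form (x ⊖ (a • y)) z ≡ form x z - a * form y z
  form-⊖ˡ x y z a = trans (Σ-cong m expand) (Σ-linear m a _ _)
    where
      distrib : ∀ a P Q R → (P - a * Q) * R ≡ P * R - a * (Q * R)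
      distrib = solve-∀
      expand : ∀ β → ⟪ x ⊖ (a • y) , coroot β ⟫ * ⟪ z , coroot β ⟫
                   ≡ ⟪ x , coroot β ⟫ * ⟪ z , coroot β ⟫ - a * (⟪ y , coroot β ⟫ * ⟪ z , coroot β ⟫)
      expand β = trans (cong (_* ⟪ z , coroot β ⟫) (⟪⊖⟫ˡ x y (coroot β) a))
                       (distrib a ⟪ x , coroot β ⟫ ⟪ y , coroot β ⟫ ⟪ z , coroot β ⟫)

  form-⊖ʳ : ∀ x y z a → form x (y ⊖ (a • z)) ≡ form x y - a * form x z
  form-⊖ʳ x y z a = trans (form-comm x (y ⊖ (a • z))) (trans (form-⊖ˡ y z x a)
                      (cong₂ (λ u v → u - a * v) (form-comm y x) (form-comm z x)))

  form-root : ∀ i x → + 2 * form x (root i) ≡ ⟪ x , coroot i ⟫ * form (root i) (root i)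
  form-root i x = begin
    + 2 * form x α                            ≡⟨ solve-for-2X (form x α) _ ⟩
    form x α - (form x α - + 2 * form x α)    ≡⟨ cong (λ t → form x α - t) two-expansions ⟩
    form x α - (form x α - P * form α α)      ≡⟨ solve-for-2X (form x α) _ ⟨
    P * form α α                              ∎
    where
      open ≡-Reasoning
      α : Lat n
      α = root i
      P : ℤ
      P = ⟪ x , coroot i ⟫
      solve-for-2X : ∀ X Y → Y ≡ X - (X - Y)
      solve-for-2X = solve-∀
      two-expansions : form x α - + 2 * form x α ≡ form x α - P * form α α
      two-expansions = begin
        form x α - + 2 * form x α   ≡⟨ form-⊖ʳ x α α (+ 2) ⟨
        form x (α ⊖ ((+ 2) • α))    ≡⟨ form-congʳ x (s-root-self i) ⟨
        form x (s i α)              ≡⟨ form-congˡ (s i α) (s-involutive i x) ⟨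
        form (s i (s i x)) (s i α)  ≡⟨ form-s-invariant i (s i x) α ⟩
        form (s i x) α              ≡⟨ form-⊖ˡ x α α P ⟩
        form x α - P * form α α     ∎

  form-root-pos : ∀ i → 0ℤ < form (root i) (root i)
  form-root-pos i = ℤP.<-≤-trans (+<+ (ℕ.s≤s ℕ.z≤n)) (subst (_≤ form (root i) (root i))
    (cong (λ t → t * t) (pair-two i))
    (term≤Σ-nonNeg m _ (λ β → square≥0 ⟪ root i , coroot β ⟫) i))

  act-cong : ∀ w {x y} → x ≋ y → act D w x ≋ act D w y
  act-cong []      x≋y = x≋y
  act-cong (t ∷ w) x≋y = s-cong t (act-cong w x≋y)

  act-++ : ∀ u v x → act D (u ++ v) x ≡ act D u (act D v x)
  act-++ []      v x = refl
  act-++ (t ∷ u) v x = cong (s t) (act-++ u v x)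

  act-∷ʳ : ∀ u j x → act D (u ++ [ j ]) x ≋ act D u (s j x)
  act-∷ʳ u j x i = cong (λ z → z i) (act-++ u [ j ] x)

  act-linear : ∀ w x y a → act D w (x ⊖ (a • y)) ≋ (act D w x ⊖ (a • act D w y))
  act-linear []      x y a k = refl
  act-linear (t ∷ w) x y a k =
    trans (s-cong t (act-linear w x y a) k) (s-linear t (act D w x) (act D w y) a k)

  act-reverse-∷ : ∀ t w x → act D (reverse (t ∷ w)) x ≡ act D (reverse w) (s t x)
  act-reverse-∷ t w x = trans (cong (λ u → act D u x) (List.unfold-reverse t w)) (act-++ (reverse w) [ t ] x)

  act-act-reverse : ∀ w x → act D w (act D (reverse w) x) ≋ x
  act-act-reverse []      x k = refl
  act-act-reverse (t ∷ w) x k = begin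
    s t (act D w (act D (reverse (t ∷ w)) x)) k  ≡⟨ cong (λ z → s t (act D w z) k) (act-reverse-∷ t w x) ⟩
    s t (act D w (act D (reverse w) (s t x))) k  ≡⟨ s-cong t (act-act-reverse w (s t x)) k ⟩
    s t (s t x) k                                ≡⟨ s-involutive t x k ⟩
    x k                                          ∎
    where open ≡-Reasoning

  act-reverse-act : ∀ w x → act D (reverse w) (act D w x) ≋ x
  act-reverse-act []      x k = refl
  act-reverse-act (t ∷ w) x k = begin
    act D (reverse (t ∷ w)) (s t (act D w x)) k  ≡⟨ cong (λ z → z k) (act-reverse-∷ t w (s t (act D w x))) ⟩
    act D (reverse w) (s t (s t (act D w x))) k  ≡⟨ act-cong (reverse w) (s-involutive t (act D w x)) k ⟩
    act D (reverse w) (act D w x) k              ≡⟨ act-reverse-act w x k ⟩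
    x k                                          ∎
    where open ≡-Reasoning

  ~-reverse : ∀ u v → _~_ D u v → _~_ D (reverse u) (reverse v)
  ~-reverse u v u~v x k = begin
    act D (reverse u) x k                                    ≡⟨ act-cong (reverse u) (act-act-reverse v x) k ⟨
    act D (reverse u) (act D v (act D (reverse v) x)) k      ≡⟨ act-cong (reverse u) (u~v _) k ⟨
    act D (reverse u) (act D u (act D (reverse v) x)) k      ≡⟨ act-reverse-act u _ k ⟩
    act D (reverse v) x k                                    ∎
    where open ≡-Reasoning

  act-root : ∀ w j → ∃ λ k → act D w (root j) ≋ root k
  act-root []      j = j , λ _ → refl
  act-root (t ∷ w) j with act-root w j
  ... | k , wj≋k with refl-closed t k
  ...   | k′ , tk≋k′ = k′ , λ i → trans (s-cong t wj≋k i) (tk≋k′ i)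

  form-act-invariant : ∀ w x y → form (act D w x) (act D w y) ≡ form x y
  form-act-invariant []      x y = refl
  form-act-invariant (t ∷ w) x y = trans (form-s-invariant t (act D w x) (act D w y)) (form-act-invariant w x y)

  pairing-transport : ∀ v j t → act D v (root j) ≋ root t →
                      ∀ x → ⟪ act D v x , coroot t ⟫ ≡ ⟪ x , coroot j ⟫
  pairing-transport v j t vj≋t x = ℤP.*-cancelʳ-≡ _ _ (form αj αj) {{ℤ.>-nonZero (form-root-pos j)}} (begin
    ⟪ act D v x , coroot t ⟫ * form αj αj     ≡⟨ cong (⟪ act D v x , coroot t ⟫ *_) form-tt≡form-jj ⟨
    ⟪ act D v x , coroot t ⟫ * form αt αt     ≡⟨ form-root t (act D v x) ⟨
    + 2 * form (act D v x) αt                 ≡⟨ cong (+ 2 *_) (form-congʳ (act D v x) vj≋t) ⟨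
    + 2 * form (act D v x) (act D v αj)       ≡⟨ cong (+ 2 *_) (form-act-invariant v x αj) ⟩
    + 2 * form x αj                           ≡⟨ form-root j x ⟩
    ⟪ x , coroot j ⟫ * form αj αj             ∎)
    where
      open ≡-Reasoning
      αj αt : Lat n
      αj = root j
      αt = root t
      form-tt≡form-jj : form αt αt ≡ form αj αj
      form-tt≡form-jj = begin
        form αt αt                      ≡⟨ form-congˡ αt (λ k → sym (vj≋t k)) ⟩
        form (act D v αj) αt            ≡⟨ form-congʳ (act D v αj) (λ k → sym (vj≋t k)) ⟩
        form (act D v αj) (act D v αj)  ≡⟨ form-act-invariant v αj αj ⟩
        form αj αj                      ∎

  lincomb-linear : ∀ c d a → lincomb (λ j → c j - a * d j) ≋ (lincomb c ⊖ (a • lincomb d))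
  lincomb-linear c d a k = trans (Σ-cong m (λ j → distrib a (c j) (d j) (root j k))) (Σ-linear m a _ _)
    where
      distrib : ∀ a c d r → (c - a * d) * r ≡ c * r - a * (d * r)
      distrib = solve-∀

  lincomb-scale : ∀ a d → lincomb (λ j → a * d j) ≋ (a • lincomb d)
  lincomb-scale a d k = trans (Σ-cong m (λ j → ℤP.*-assoc a (d j) (root j k))) (Σ-scale m a _)

  lincomb-δ : ∀ t → lincomb (δ t) ≋ root t
  lincomb-δ t k = Σ-δ m t (λ j → root j k)

  Supported-linear : ∀ {c d} a → Supported c → Supported d → Supported (λ j → c j - a * d j)
  Supported-linear {c} {d} a c-supp d-supp j ¬Δj =
    trans (cong₂ (λ u v → u - a * v) (c-supp j ¬Δj) (d-supp j ¬Δj)) (x-a*0≡x 0ℤ a)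

  δ-Supported : ∀ t → Δ t → Supported (δ t)
  δ-Supported t Δt j ¬Δj = δ-off t j (λ t≡j → ¬Δj (subst Δ t≡j Δt))

  coords-unique : ∀ {c d} → Supported c → Supported d → lincomb c ≋ lincomb d → ∀ j → c j ≡ d j
  coords-unique {c} {d} c-supp d-supp c≋d j =
    ℤP.i-j≡0⇒i≡j (c j) (d j) (trans (cong (λ t → c j - t) (sym (ℤP.*-identityˡ (d j)))) difference-vanishes)
    where
      difference-vanishes : c j - 1ℤ * d j ≡ 0ℤ
      difference-vanishes = base-indep _ (Supported-linear 1ℤ c-supp d-supp) (λ k →
        trans (lincomb-linear c d 1ℤ k)
              (trans (cong (λ u → lincomb c k - 1ℤ * u) (sym (c≋d k))) (self-cancel (lincomb c k)))) j
        where
          self-cancel : ∀ x → x - 1ℤ * x ≡ 0ℤ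
          self-cancel = solve-∀

  Positive : Lat n → Set
  Positive x = ∃ λ c → Supported c × (∀ j → 0ℤ ≤ c j) × x ≋ lincomb c

  Negative : Lat n → Set
  Negative x = ∃ λ c → Supported c × (∀ j → c j ≤ 0ℤ) × x ≋ lincomb c

  Positive-cong : ∀ {x y} → x ≋ y → Positive x → Positive y
  Positive-cong x≋y (c , c-supp , c≥0 , x≋c) = c , c-supp , c≥0 , λ k → trans (sym (x≋y k)) (x≋c k)

  Negative-cong : ∀ {x y} → x ≋ y → Negative x → Negative y
  Negative-cong x≋y (c , c-supp , c≤0 , x≋c) = c , c-supp , c≤0 , λ k → trans (sym (x≋y k)) (x≋c k)

  root-sign : ∀ k → Positive (root k) ⊎ Negative (root k)
  root-sign k with base-span k
  ... | c , c-supp , inj₁ c≥0 , k≋c = inj₁ (c , c-supp , c≥0 , k≋c)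
  ... | c , c-supp , inj₂ c≤0 , k≋c = inj₂ (c , c-supp , c≤0 , k≋c)

  Positive-coords : ∀ {x c} → Positive x → Supported c → x ≋ lincomb c → ∀ j → 0ℤ ≤ c j
  Positive-coords (d , d-supp , d≥0 , x≋d) c-supp x≋c j =
    subst (0ℤ ≤_) (coords-unique d-supp c-supp (λ i → trans (sym (x≋d i)) (x≋c i)) j) (d≥0 j)

  Negative-coords : ∀ {x c} → Negative x → Supported c → x ≋ lincomb c → ∀ j → c j ≤ 0ℤ
  Negative-coords (d , d-supp , d≤0 , x≋d) c-supp x≋c j =
    subst (_≤ 0ℤ) (coords-unique d-supp c-supp (λ i → trans (sym (x≋d i)) (x≋c i)) j) (d≤0 j)

  coords-sign : ∀ {k c} → Supported c → root k ≋ lincomb c → (∀ j → 0ℤ ≤ c j) ⊎ (∀ j → c j ≤ 0ℤ)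
  coords-sign {k} c-supp k≋c with root-sign k
  ... | inj₁ pos = inj₁ (Positive-coords pos c-supp k≋c)
  ... | inj₂ neg = inj₂ (Negative-coords neg c-supp k≋c)

  form-lincomb : ∀ x c → form x (lincomb c) ≡ Σℤ m (λ j → c j * form x (root j))
  form-lincomb x c = begin
    Σℤ m (λ β → ⟪ x , coroot β ⟫ * ⟪ lincomb c , coroot β ⟫)
      ≡⟨ Σ-cong m (λ β → cong (⟪ x , coroot β ⟫ *_) (⟪Σ⟫ˡ m c root (coroot β))) ⟩
    Σℤ m (λ β → ⟪ x , coroot β ⟫ * Σℤ m (λ j → c j * ⟪ root j , coroot β ⟫))
      ≡⟨ Σ-interchange m m (λ β → ⟪ x , coroot β ⟫) c (λ j β → ⟪ root j , coroot β ⟫) ⟩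
    Σℤ m (λ j → c j * form x (root j))
      ∎
    where open ≡-Reasoning

  -- ⟪ x , _ ⟫ is not additive on coroots, but form x is additive on roots and
  -- has the same sign on each root (form-root).
  pairing-nonPos-by-coords : ∀ {k} x d → root k ≋ lincomb d →
                             (∀ r → d r * ⟪ x , coroot r ⟫ ≤ 0ℤ) → ⟪ x , coroot k ⟫ ≤ 0ℤ
  pairing-nonPos-by-coords {k} x d k≋d terms≤0 = *-cancelʳ-≤0 (form-root-pos k) (begin
    ⟪ x , coroot k ⟫ * form (root k) (root k)     ≡⟨ form-root k x ⟨
    + 2 * form x (root k)                         ≡⟨ cong (+ 2 *_) (form-congʳ x k≋d) ⟩
    + 2 * form x (lincomb d)                      ≡⟨ cong (+ 2 *_) (form-lincomb x d) ⟩
    + 2 * Σℤ m (λ r → d r * form x (root r))      ≡⟨ Σ-scale m (+ 2) _ ⟨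
    Σℤ m (λ r → + 2 * (d r * form x (root r)))    ≡⟨ Σ-cong m rescale ⟩
    Σℤ m (λ r → d r * ⟪ x , coroot r ⟫ * form (root r) (root r))
      ≤⟨ Σ-nonPos m _ (λ r → nonPos*nonNeg≤0 (terms≤0 r) (ℤP.<⇒≤ (form-root-pos r))) ⟩
    0ℤ                                            ∎)
    where
      open ℤP.≤-Reasoning
      swap : ∀ a b c → a * (b * c) ≡ b * (a * c)
      swap = solve-∀
      rescale : ∀ r → + 2 * (d r * form x (root r)) ≡ d r * ⟪ x , coroot r ⟫ * form (root r) (root r)
      rescale r = trans (swap (+ 2) (d r) _) (trans (cong (d r *_) (form-root r x)) (sym (ℤP.*-assoc (d r) _ _)))

  Δ? : ∀ j → Dec (Δ j)
  Δ? j = simple j Bool.≟ Bool.true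

  simple-positive : ∀ j → Δ j → Positive (root j)
  simple-positive j Δj = δ j , δ-Supported j Δj , δ-nonNeg j , λ k → sym (lincomb-δ j k)

  Antidominant : Lat n → Set
  Antidominant y = ∀ p → Δ p → ⟪ y , coroot p ⟫ ≤ 0ℤ

  antidominant-positive : ∀ y {k} → Antidominant y → Positive (root k) → ⟪ y , coroot k ⟫ ≤ 0ℤ
  antidominant-positive y y-anti (c , c-supp , c≥0 , k≋c) = pairing-nonPos-by-coords y c k≋c term≤0
    where
      term≤0 : ∀ r → c r * ⟪ y , coroot r ⟫ ≤ 0ℤ
      term≤0 r with Δ? r
      ... | yes Δr = nonNeg*nonPos≤0 (c≥0 r) (y-anti r Δr)
      ... | no ¬Δr = ≡0⇒*≤0 _ (c-supp r ¬Δr)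

  positive∧s-negative⇒simple : ∀ t k → Δ t → Positive (root k) → Negative (s t (root k)) → root k ≋ root t
  positive∧s-negative⇒simple t k Δt (c , c-supp , c≥0 , k≋c) tk-neg =
    k≋t (reduced t k 1ℤ (c t) (λ ()) k≋ct•t)
    where
      open ≡-Reasoning
      a : ℤ
      a = ⟪ root k , coroot t ⟫
      tk≋coords : s t (root k) ≋ lincomb (λ j → c j - a * δ t j)
      tk≋coords i = trans (cong₂ (λ u v → u - a * v) (k≋c i) (sym (lincomb-δ t i))) (sym (lincomb-linear c (δ t) a i))
      c≡0-off-t : ∀ j → j ≢ t → c j ≡ 0ℤ
      c≡0-off-t j j≢t = ℤP.≤-antisym (subst (_≤ 0ℤ) tk-coord≡c (tk-coord≤0 j)) (c≥0 j)
        where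
          tk-coord≤0 : ∀ j → c j - a * δ t j ≤ 0ℤ
          tk-coord≤0 = Negative-coords tk-neg (Supported-linear a c-supp (δ-Supported t Δt)) tk≋coords
          tk-coord≡c : c j - a * δ t j ≡ c j
          tk-coord≡c = trans (cong (λ v → c j - a * v) (δ-off t j (j≢t ∘ sym))) (x-a*0≡x (c j) a)
      c-concentrated : ∀ j → c j ≡ c t * δ t j
      c-concentrated j with j ≟ t
      ... | yes refl = sym (trans (cong (c t *_) (δ-diag t)) (ℤP.*-identityʳ (c t)))
      ... | no j≢t  = trans (c≡0-off-t j j≢t) (sym (trans (cong (c t *_) (δ-off t j (j≢t ∘ sym))) (ℤP.*-zeroʳ (c t))))
      k≋ct•t : (1ℤ • root k) ≋ (c t • root t)
      k≋ct•t i = begin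
        1ℤ * root k i                   ≡⟨ ℤP.*-identityˡ _ ⟩
        root k i                        ≡⟨ k≋c i ⟩
        lincomb c i                     ≡⟨ Σ-cong m (λ j → cong (_* root j i) (c-concentrated j)) ⟩
        lincomb (λ j → c t * δ t j) i   ≡⟨ lincomb-scale (c t) (δ t) i ⟩
        c t * lincomb (δ t) i           ≡⟨ cong (c t *_) (lincomb-δ t i) ⟩
        c t * root t i                  ∎
      k≋t : 1ℤ ≡ c t ⊎ 1ℤ ≡ - c t → root k ≋ root t
      k≋t (inj₁ 1≡ct)  i = begin
        root k i         ≡⟨ ℤP.*-identityˡ _ ⟨
        1ℤ * root k i    ≡⟨ k≋ct•t i ⟩
        c t * root t i   ≡⟨ cong (_* root t i) 1≡ct ⟨
        1ℤ * root t i    ≡⟨ ℤP.*-identityˡ _ ⟩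
        root t i         ∎
      k≋t (inj₂ 1≡-ct) = ⊥-elim (1≰0 (subst (_≤ 0ℤ) (sym 1≡-ct) (ℤP.neg-mono-≤ (c≥0 t))))

  act-∷ʳ-conjugate : ∀ v j t → act D v (root j) ≋ root t → ∀ x → act D (v ++ [ j ]) x ≋ s t (act D v x)
  act-∷ʳ-conjugate v j t vj≋t x i = begin
    act D (v ++ [ j ]) x i                  ≡⟨ act-∷ʳ v j x i ⟩
    act D v (s j x) i                       ≡⟨ act-linear v x (root j) ⟪ x , coroot j ⟫ i ⟩
    act D v x i - ⟪ x , coroot j ⟫ * act D v (root j) i
      ≡⟨ cong₂ (λ u w → act D v x i - u * w) (sym (pairing-transport v j t vj≋t x)) (vj≋t i) ⟩
    s t (act D v x) i                       ∎
    where open ≡-Reasoning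

  -- If v α_j is positive and s_t v α_j negative, then v α_j = α_t and s_t v s_j = v.
  exchange : ∀ v j → All Δ v → Δ j → Negative (act D v (root j)) →
             ∃ λ v′ → All Δ v′ × suc (length v′) ≡ length v × _~_ D v′ (v ++ [ j ])
  exchange []      j []          Δj j-neg = ⊥-elim (1≰0 (subst (_≤ 0ℤ) (δ-diag j)
    (Negative-coords j-neg (δ-Supported j Δj) (λ k → sym (lincomb-δ j k)) j)))
  exchange (t ∷ v) j (Δt ∷ Δv) Δj tvj-neg with act-root v j
  ... | k , vj≋k with root-sign k
  ...   | inj₂ k-neg with exchange v j Δv Δj (Negative-cong (λ i → sym (vj≋k i)) k-neg)
  ...     | v′ , Δv′ , |v′|+1≡|v| , v′~vj =
    t ∷ v′ , Δt ∷ Δv′ , cong suc |v′|+1≡|v| , λ x → s-cong t (v′~vj x)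
  exchange (t ∷ v) j (Δt ∷ Δv) Δj tvj-neg | k , vj≋k | inj₁ k-pos =
    v , Δv , refl , λ x i → sym (trans (s-cong t (act-∷ʳ-conjugate v j t vj≋t x) i) (s-involutive t (act D v x) i))
    where
      vj≋t : act D v (root j) ≋ root t
      vj≋t i = trans (vj≋k i) (positive∧s-negative⇒simple t k Δt k-pos (Negative-cong (s-cong t vj≋k) tvj-neg) i)

  act-s-self-negative : ∀ w j → Positive (act D w (root j)) → Negative (act D w (s j (root j)))
  act-s-self-negative w j (c , c-supp , c≥0 , wj≋c) =
    (λ i → c i - (+ 2) * c i) , Supported-linear (+ 2) c-supp c-supp , c-2c≤0 , λ i → begin
      act D w (s j (root j)) i                               ≡⟨ act-cong w (s-root-self j) i ⟩
      act D w (root j ⊖ ((+ 2) • root j)) i                  ≡⟨ act-linear w (root j) (root j) (+ 2) i ⟩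
      act D w (root j) i - (+ 2) * act D w (root j) i        ≡⟨ cong₂ (λ u v → u - (+ 2) * v) (wj≋c i) (wj≋c i) ⟩
      lincomb c i - (+ 2) * lincomb c i                      ≡⟨ lincomb-linear c c (+ 2) i ⟨
      lincomb (λ i → c i - (+ 2) * c i) i                    ∎
    where
      open ≡-Reasoning
      c-2c≡-c : ∀ x → x - (+ 2) * x ≡ - x
      c-2c≡-c = solve-∀
      c-2c≤0 : ∀ i → c i - (+ 2) * c i ≤ 0ℤ
      c-2c≤0 i = subst (_≤ 0ℤ) (sym (c-2c≡-c (c i))) (ℤP.neg-mono-≤ (c≥0 i))

  HasLength-∷ʳ : ∀ w k j → HasLength D w k → Δ j → Positive (act D w (root j)) →
                 HasLength D (w ++ [ j ]) (suc k)
  HasLength-∷ʳ w k j ((v , Δv , |v|≡k , v~w) , minimal) Δj wj-pos =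
    (v ++ [ j ] , ++⁺ Δv (Δj ∷ []) , |vj|≡k+1 , vj~wj) , minimal′
    where
      |vj|≡k+1 : length (v ++ [ j ]) ≡ suc k
      |vj|≡k+1 = trans (List.length-++ v) (trans (cong (ℕ._+ 1) |v|≡k) (ℕP.+-comm k 1))
      vj~wj : _~_ D (v ++ [ j ]) (w ++ [ j ])
      vj~wj x i = trans (act-∷ʳ v j x i) (trans (v~w (s j x) i) (sym (act-∷ʳ w j x i)))
      uj-negative : ∀ u → _~_ D u (w ++ [ j ]) → Negative (act D u (root j))
      uj-negative u u~wj = Negative-cong (λ i → sym (trans (u~wj (root j) i) (act-∷ʳ w j (root j) i)))
                                         (act-s-self-negative w j wj-pos)
      minimal′ : ∀ u → All Δ u → _~_ D u (w ++ [ j ]) → suc k ℕ.≤ length u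
      minimal′ u Δu u~wj with exchange u j Δu Δj (uj-negative u u~wj)
      ... | u′ , Δu′ , |u′|+1≡|u| , u′~uj = subst (suc k ℕ.≤_) |u′|+1≡|u| (ℕ.s≤s (minimal u′ Δu′ u′~w))
        where
          u′~w : _~_ D u′ w
          u′~w x i = begin
            act D u′ x i                  ≡⟨ u′~uj x i ⟩
            act D (u ++ [ j ]) x i        ≡⟨ act-∷ʳ u j x i ⟩
            act D u (s j x) i             ≡⟨ u~wj (s j x) i ⟩
            act D (w ++ [ j ]) (s j x) i  ≡⟨ act-∷ʳ w j (s j x) i ⟩
            act D w (s j (s j x)) i       ≡⟨ act-cong w (s-involutive j x) i ⟩
            act D w x i                   ∎
            where open ≡-Reasoning

  HasLength-reverse : ∀ w k → HasLength D w k → HasLength D (reverse w) k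
  HasLength-reverse w k ((v , Δv , |v|≡k , v~w) , minimal) =
    (reverse v , All-reverse Δv , trans (List.length-reverse v) |v|≡k , ~-reverse v w v~w) ,
    λ u Δu u~w⁻¹ → subst (k ℕ.≤_) (List.length-reverse u) (minimal (reverse u) (All-reverse Δu)
                     (subst (_~_ D (reverse u)) (List.reverse-involutive w) (~-reverse u (reverse w) u~w⁻¹)))

  module Parabolic (J : Fin m → Set) (J⊆Δ : ∀ j → J j → Δ j) where

    act-coords-outside : ∀ u → All J u → ∀ c → Supported c →
                         ∃ λ c′ → Supported c′ × (∀ p → ¬ J p → c′ p ≡ c p) × act D u (lincomb c) ≋ lincomb c′
    act-coords-outside []      []        c c-supp = c , c-supp , (λ _ _ → refl) , (λ _ → refl)
    act-coords-outside (t ∷ u) (Jt ∷ Ju) c c-supp with act-coords-outside u Ju c c-supp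
    ... | c′ , c′-supp , c′-outside , uc≋c′ =
      (λ j → c′ j - a * δ t j) , Supported-linear a c′-supp (δ-Supported t (J⊆Δ t Jt)) , outside , tuc≋coords
      where
        a : ℤ
        a = ⟪ lincomb c′ , coroot t ⟫
        outside : ∀ p → ¬ J p → c′ p - a * δ t p ≡ c p
        outside p ¬Jp = trans (cong (λ v → c′ p - a * v) (δ-off t p (λ t≡p → ¬Jp (subst J t≡p Jt))))
                              (trans (x-a*0≡x (c′ p) a) (c′-outside p ¬Jp))
        tuc≋coords : s t (act D u (lincomb c)) ≋ lincomb (λ j → c′ j - a * δ t j)
        tuc≋coords k = trans (s-cong t uc≋c′ k) (sym (trans (lincomb-linear c′ (δ t) a k)
                         (cong (λ v → lincomb c′ k - a * v) (lincomb-δ t k))))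

    act-simple-coords : ∀ u → All J u → ∀ β → Δ β →
                        ∃ λ c → Supported c × (∀ r → ¬ J r → c r ≡ δ β r) × act D u (root β) ≋ lincomb c
    act-simple-coords u Ju β Δβ with act-coords-outside u Ju (δ β) (δ-Supported β Δβ)
    ... | c , c-supp , c-outside , uδ≋c =
      c , c-supp , c-outside , λ i → trans (act-cong u (λ k → sym (lincomb-δ β k)) i) (uδ≋c i)

    act-simple-outside : ∀ u → All J u → ∀ β → Δ β → ¬ J β →
                         ∃ λ c → Supported c × (∀ r → 0ℤ ≤ c r) × act D u (root β) ≋ lincomb c × c β ≡ 1ℤ
    act-simple-outside u Ju β Δβ ¬Jβ with act-simple-coords u Ju β Δβ | act-root u β
    ... | c , c-supp , c-outside , uβ≋c | k , uβ≋k = c , c-supp , c≥0 , uβ≋c , cβ≡1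
      where
        cβ≡1 : c β ≡ 1ℤ
        cβ≡1 = trans (c-outside β ¬Jβ) (δ-diag β)
        c≥0 : ∀ r → 0ℤ ≤ c r
        c≥0 with coords-sign c-supp (λ i → trans (sym (uβ≋k i)) (uβ≋c i))
        ... | inj₁ c≥0 = c≥0
        ... | inj₂ c≤0 = ⊥-elim (1≰0 (subst (_≤ 0ℤ) cβ≡1 (c≤0 β)))

    act-antidominant-outside : ∀ y v → Antidominant y → All J v → ∀ β → Δ β → ¬ J β →
                               ⟪ act D v y , coroot β ⟫ ≤ 0ℤ
    act-antidominant-outside y v y-anti Jv β Δβ ¬Jβ with act-root (reverse v) β
    ... | k , v⁻¹β≋k = subst (_≤ 0ℤ) (sym (pairing-transport v k β vk≋β y)) (antidominant-positive y y-anti k-pos)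
      where
        vk≋β : act D v (root k) ≋ root β
        vk≋β i = trans (act-cong v (λ i → sym (v⁻¹β≋k i)) i) (act-act-reverse v (root β) i)
        k-pos : Positive (root k)
        k-pos with act-simple-outside (reverse v) (All-reverse Jv) β Δβ ¬Jβ
        ... | c , c-supp , c≥0 , v⁻¹β≋c , _ = c , c-supp , c≥0 , λ i → trans (sym (v⁻¹β≋k i)) (v⁻¹β≋c i)

    longest-negative : ∀ w → IsLongestIn D J w → ∀ j → J j → Negative (act D w (root j))
    longest-negative w (Jw , k , ℓw≡k , maximal) j Jj with act-root w j
    ... | k′ , wj≋k′ with root-sign k′
    ...   | inj₂ k′-neg = Negative-cong (λ i → sym (wj≋k′ i)) k′-neg
    ...   | inj₁ k′-pos = ⊥-elim (ℕP.n≮n k (maximal (w ++ [ j ]) (suc k) (++⁺ Jw (Jj ∷ []))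
                            (HasLength-∷ʳ w k j ℓw≡k (J⊆Δ j Jj) (Positive-cong (λ i → sym (wj≋k′ i)) k′-pos))))

    longest-reverse : ∀ w → IsLongestIn D J w → IsLongestIn D J (reverse w)
    longest-reverse w (Jw , k , ℓw≡k , maximal) = All-reverse Jw , k , HasLength-reverse w k ℓw≡k , maximal

  σ-injective : ∀ {i j} → σ i ≡ σ j → i ≡ j
  σ-injective {i} {j} σi≡σj = root-inj i j λ k → begin
    root i k                      ≡⟨ τ-inv₂ (root i) k ⟨
    app τ⁻¹ (app τ (root i)) k    ≡⟨ app-cong τ⁻¹ τi≋τj k ⟩
    app τ⁻¹ (app τ (root j)) k    ≡⟨ τ-inv₂ (root j) k ⟩
    root j k                      ∎
    where
      open ≡-Reasoning
      τi≋τj : app τ (root i) ≋ app τ (root j)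
      τi≋τj k = trans (sym (σ-root i k)) (trans (cong (λ l → root l k) σi≡σj) (σ-root j k))

  σ^-injective : ∀ a {i j} → (σ ^[ a ]) i ≡ (σ ^[ a ]) j → i ≡ j
  σ^-injective zero    e = e
  σ^-injective (suc a) e = σ^-injective a (σ-injective e)

  Δ-σ^ : ∀ a {i} → Δ i → Δ ((σ ^[ a ]) i)
  Δ-σ^ zero    Δi = Δi
  Δ-σ^ (suc a) Δi = σ-simple _ (Δ-σ^ a Δi)

  module Levi (μ : Lat n) where

    I? : ∀ j → Dec (I D μ j)
    I? j with Δ? j | ⟪ root j , μ ⟫ ℤ.≟ 0ℤ
    ... | yes Δj | yes j∈L = yes (Δj , j∈L)
    ... | no ¬Δj | _       = no (¬Δj ∘ proj₁)
    ... | _      | no j∉L  = no (j∉L ∘ proj₂)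

    I₀-reflect : ∀ a α → Δ α → I₀ D μ ((σ ^[ a ]) α) → I₀ D μ α
    I₀-reflect a α Δα (_ , in-every-σ^I) = Δα , λ l → σ^-back l (in-every-σ^I (a ℕ.+ l))
      where
        σ^-back : ∀ l → (∃ λ j → I D μ j × (σ ^[ a ℕ.+ l ]) j ≡ (σ ^[ a ]) α) →
                  ∃ λ j → I D μ j × (σ ^[ l ]) j ≡ α
        σ^-back l (j , Ij , e) = j , Ij , σ^-injective a (trans (sym (^[]-+ σ a l j)) e)

    positive-outside-L : Dominant D μ → ∀ {k c p} → Supported c → (∀ r → 0ℤ ≤ c r) → root k ≋ lincomb c →
                         Δ p → ¬ I D μ p → c p ≡ 1ℤ → ¬ InL D μ k
    positive-outside-L dom {k} {c} {p} c-supp c≥0 k≋c Δp ¬Ip cp≡1 k∈L = ℤP.<-irrefl refl (begin-strict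
      0ℤ                                     <⟨ 0<p ⟩
      ⟪ root p , μ ⟫                         ≡⟨ ℤP.*-identityˡ _ ⟨
      1ℤ * ⟪ root p , μ ⟫                    ≡⟨ cong (_* ⟪ root p , μ ⟫) cp≡1 ⟨
      c p * ⟪ root p , μ ⟫                   ≤⟨ term≤Σ-nonNeg m _ term≥0 p ⟩
      Σℤ m (λ r → c r * ⟪ root r , μ ⟫)      ≡⟨ ⟪Σ⟫ˡ m c root μ ⟨
      ⟪ lincomb c , μ ⟫                      ≡⟨ ⟪⟫-congˡ μ k≋c ⟨
      ⟪ root k , μ ⟫                         ≡⟨ k∈L ⟩
      0ℤ                                     ∎)
      where
        open ℤP.≤-Reasoning
        0<p : 0ℤ < ⟪ root p , μ ⟫
        0<p = ℤP.≤∧≢⇒< (dom p (simple-positive p Δp)) (λ 0≡p → ¬Ip (Δp , sym 0≡p))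
        term≥0 : ∀ r → 0ℤ ≤ c r * ⟪ root r , μ ⟫
        term≥0 r with Δ? r
        ... | yes Δr = nonNeg*nonNeg≥0 (c≥0 r) (dom r (simple-positive r Δr))
        ... | no ¬Δr = ≡0⇒*≥0 _ (c-supp r ¬Δr)

    longest-antidominant : Dominant D μ → ∀ λ′ → InCGS D μ λ′ →
                           ∀ w → IsLongestIn D (I D μ) w → Antidominant (act D w λ′)
    longest-antidominant dom λ′ (λ′-I-dominant , λ′-outside-L) w w-longest p Δp with act-root (reverse w) p
    ... | k , w⁻¹p≋k = subst (_≤ 0ℤ) (sym (pairing-transport w k p wk≋p λ′)) (λ′-k≤0 (I? p))
      where
        open Parabolic (I D μ) (λ _ → proj₁)
        Iw⁻¹ : All (I D μ) (reverse w)
        Iw⁻¹ = All-reverse (proj₁ w-longest)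
        wk≋p : act D w (root k) ≋ root p
        wk≋p i = trans (act-cong w (λ i → sym (w⁻¹p≋k i)) i) (act-act-reverse w (root p) i)
        λ′-k≤0 : Dec (I D μ p) → ⟪ λ′ , coroot k ⟫ ≤ 0ℤ
        λ′-k≤0 (yes Ip) with act-simple-coords (reverse w) Iw⁻¹ p Δp
        ... | c , c-supp , c-outside , w⁻¹p≋c = pairing-nonPos-by-coords λ′ c k≋c term≤0
          where
            k≋c : root k ≋ lincomb c
            k≋c i = trans (sym (w⁻¹p≋k i)) (w⁻¹p≋c i)
            c≤0 : ∀ r → c r ≤ 0ℤ
            c≤0 = Negative-coords (longest-negative (reverse w) (longest-reverse w w-longest) p Ip) c-supp w⁻¹p≋c
            term≤0 : ∀ r → c r * ⟪ λ′ , coroot r ⟫ ≤ 0ℤ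
            term≤0 r with I? r
            ... | yes Ir = nonPos*nonNeg≤0 (c≤0 r) (λ′-I-dominant r Ir)
            ... | no ¬Ir = ≡0⇒*≤0 _ (trans (c-outside r ¬Ir) (δ-off p r (λ p≡r → ¬Ir (subst (I D μ) p≡r Ip))))
        λ′-k≤0 (no ¬Ip) with act-simple-outside (reverse w) Iw⁻¹ p Δp ¬Ip
        ... | c , c-supp , c≥0 , w⁻¹p≋c , cp≡1 =
          λ′-outside-L k (c , c-supp , c≥0 , k≋c) (positive-outside-L dom c-supp c≥0 k≋c Δp ¬Ip cp≡1)
          where
            k≋c : root k ≋ lincomb c
            k≋c i = trans (sym (w⁻¹p≋k i)) (w⁻¹p≋c i)

    lwSum-nonPos : ∀ q E λ₀ α r →
                   All (λ e → ∀ i → ⟪ act D (proj₁ e) λ₀ , coroot ((σ ^[ i ]) α) ⟫ ≤ 0ℤ) E →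
                   lwSum D μ q E λ₀ α r ≤ 0ℤ
    lwSum-nonPos q []            λ₀ α r []                         = ℤP.≤-refl
    lwSum-nonPos q ((w , k) ∷ E) λ₀ α r (w-terms≤0 ∷ E-terms≤0) =
      ℤP.+-mono-≤ (Σℕ-nonPos r _ (λ i → nonNeg*nonPos≤0 {+ (q ℕ.^ (i ℕ.+ k))} (+≤+ ℕ.z≤n) (w-terms≤0 i)))
                  (lwSum-nonPos q E λ₀ α r E-terms≤0)

lemma5p2p4 : ∀ {n : ℕ} (D : FrobRootDatum n) (q : ℕ) → IsPrimePower q →
               (μ : Lat n) → Dominant D μ →
               (λ' : Lat n) → InCGS D μ λ' → InClw D μ q λ'
lemma5p2p4 {n} D q _ μ dom λ′ λ′∈CGS = proj₁ λ′∈CGS , lw-inequality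
  where
    open FrobRootDatum D
    open RootDatumTheory D
    open Levi μ
    open Parabolic (I₀ D μ) (λ _ → proj₁)

    lw-inequality : ∀ w0I w0I₀ → IsLongestIn D (I D μ) w0I → IsLongestIn D (I₀ D μ) w0I₀ →
                    ∀ E → EnumWL0Fq D μ E → ∀ α → Δ α → ¬ I₀ D μ α → ∀ r → OrbitLen D μ α r →
                    lwSum D μ q E (act D (w0I₀ ++ w0I) λ′) α r ≤ 0ℤ
    lw-inequality w0I w0I₀ w0I-longest (w0I₀∈WI₀ , _) E (E⊆WL₀ , _) α Δα α∉I₀ r _ =
      lwSum-nonPos q E _ α r (All.map (λ e∈WL₀ → term≤0 _ (proj₁ e∈WL₀)) E⊆WL₀)
      where
        y : Lat n
        y = act D w0I λ′
        term≤0 : ∀ w → All (I₀ D μ) w → ∀ i →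
                 ⟪ act D w (act D (w0I₀ ++ w0I) λ′) , coroot ((σ ^[ i ]) α) ⟫ ≤ 0ℤ
        term≤0 w w∈WI₀ i = subst (λ z → ⟪ z , coroot ((σ ^[ i ]) α) ⟫ ≤ 0ℤ)
          (trans (act-++ w w0I₀ y) (cong (act D w) (sym (act-++ w0I₀ w0I λ′))))
          (act-antidominant-outside y (w ++ w0I₀) (longest-antidominant dom λ′ λ′∈CGS w0I w0I-longest)
             (++⁺ w∈WI₀ w0I₀∈WI₀) _ (Δ-σ^ i Δα) (α∉I₀ ∘ I₀-reflect i α Δα))
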